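{- Let $R\{\}\{\}$ be a two-hole context, and consider the structure $R\{\Delta\}\{*\}$, in which $\Delta$ fills the first hole and the special leaf $*$ fills the second (so $\Delta$ does not contain $*$). Then $\Delta$ occurs as a substructure of $\overline{R\{\Delta\}\{*\}}$, and for every structure $\Pi$, replacing this occurrence of $\Delta$ by $\Pi$ in $\overline{R\{\Delta\}\{*\}}$ yields $\overline{R\{\Pi\}\{*\}}$.
   Context: Structures over formulas: $\Gamma::=\varnothing\mid F\mid(\Gamma,\Gamma)$, identified modulo $(\varnothing,\Gamma)=(\Gamma,\varnothing)=\Gamma$. A context is a structure with some leaf occurrences replaced by holes, filled in order. For a structure $\Theta\{*\}$ containing exactly one occurrence of a special leaf $*$, the designated structure $\overline{\Theta\{*\}}$ is defined recursively: $\overline{(R\{*\},\Delta)}:=\overline{(\Delta,R\{*\})}$ (when $*$ is in the left component); $\overline{(\Gamma,(\Delta,P\{*\}))}:=\overline{((\Gamma,\Delta),P\{*\})}$; $\overline{(\Gamma,(D\{*\},\Pi))}:=\overline{((\Pi,\Gamma),D\{*\})}$; $\overline{(\Gamma,*)}:=\Gamma$; $\overline{*}:=\varnothing$. -}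

module Defs where

open import Data.Bool using (Bool; true; false; if_then_else_; _∨_)
open import Data.Nat using (ℕ; zero; suc; _+_)
open import Data.Sum using (_⊎_; inj₁; inj₂)
open import Data.Product using (_×_; _,_; proj₁)
open import Data.List using (List; []; _∷_)

infixr 5 _,,_
data Tree (L : Set) : Set where
  ∅    : Tree L
  leaf : L → Tree L
  _,,_ : Tree L → Tree L → Tree L

mapT : {A B : Set} → (A → B) → Tree A → Tree B
mapT f ∅ = ∅
mapT f (leaf a) = leaf (f a)
mapT f (l ,, r) = mapT f l ,, mapT f r

infix 4 _≈_
data _≈_ {L : Set} : Tree L → Tree L → Set where
  ≈-refl  : ∀ {Γ} → Γ ≈ Γ
  ≈-sym   : ∀ {Γ Δ} → Γ ≈ Δ → Δ ≈ Γ
  ≈-trans : ∀ {Γ Δ Θ} → Γ ≈ Δ → Δ ≈ Θ → Γ ≈ Θ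
  ≈-cong  : ∀ {Γ Γ' Δ Δ'} → Γ ≈ Γ' → Δ ≈ Δ' → (Γ ,, Δ) ≈ (Γ' ,, Δ')
  unitˡ   : ∀ {Γ} → (∅ ,, Γ) ≈ Γ
  unitʳ   : ∀ {Γ} → (Γ ,, ∅) ≈ Γ

Str : Set → Set
Str Fm = Tree Fm

data Hole : Set where
  □ : Hole

Ctx : Set → Set
Ctx Fm = Tree (Fm ⊎ Hole)

holes : {Fm : Set} → Ctx Fm → ℕ
holes ∅ = 0
holes (leaf (inj₁ _)) = 0
holes (leaf (inj₂ _)) = 1
holes (l ,, r) = holes l + holes r

fill : {A : Set} → Tree (A ⊎ Hole) → List (Tree A) → Tree A × List (Tree A)
fill ∅ xs = ∅ , xs
fill (leaf (inj₁ a)) xs = leaf a , xs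
fill (leaf (inj₂ □)) [] = ∅ , []
fill (leaf (inj₂ □)) (x ∷ xs) = x , xs
fill (l ,, r) xs with fill l xs
... | l' , ys with fill r ys
... | r' , zs = (l' ,, r') , zs

plug : {A : Set} → Tree (A ⊎ Hole) → List (Tree A) → Tree A
plug C xs = proj₁ (fill C xs)

_[_] : {Fm : Set} → Ctx Fm → Str Fm → Str Fm
C [ Δ ] = plug C (Δ ∷ [])

data Star : Set where
  ★ : Star

SStr : Set → Set
SStr Fm = Tree (Fm ⊎ Star)

_⟨_⟩⟨★⟩ : {Fm : Set} → Ctx Fm → Str Fm → SStr Fm
R ⟨ Δ ⟩⟨★⟩ = plug (mapT emb R) (mapT inj₁ Δ ∷ leaf (inj₂ ★) ∷ [])
  where
  emb : _ → _
  emb (inj₁ a) = inj₁ (inj₁ a)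
  emb (inj₂ h) = inj₂ h

hasStar : {Fm : Set} → SStr Fm → Bool
hasStar ∅ = false
hasStar (leaf (inj₁ _)) = false
hasStar (leaf (inj₂ _)) = true
hasStar (l ,, r) = hasStar l ∨ hasStar r

-- Star-free parts viewed as structures (★ ↦ ∅ never happens on star-free input).
strip : {Fm : Set} → SStr Fm → Str Fm
strip ∅ = ∅
strip (leaf (inj₁ a)) = leaf a
strip (leaf (inj₂ _)) = ∅
strip (l ,, r) = strip l ,, strip r

-- ovAcc Γ T = designated structure of (Γ , T), for T containing ★.
ovAcc : {Fm : Set} → Str Fm → SStr Fm → Str Fm
ovAcc Γ ∅ = Γ
ovAcc Γ (leaf (inj₁ _)) = Γ
ovAcc Γ (leaf (inj₂ ★)) = Γ
ovAcc Γ (A ,, B) = if hasStar B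
  then ovAcc (Γ ,, strip A) B                                  -- (Γ,(Δ,P{*})) ↦ ((Γ,Δ),P{*})
  else ovAcc (strip B ,, Γ) A                                  -- (Γ,(D{*},Π)) ↦ ((Π,Γ),D{*})

-- Designated structure of a structure with exactly one ★.
designated : {Fm : Set} → SStr Fm → Str Fm
designated ∅ = ∅
designated (leaf (inj₁ _)) = ∅
designated (leaf (inj₂ ★)) = ∅
designated (A ,, B) = if hasStar A
  then ovAcc (strip B) A                                       -- (R{*},Δ) ↦ (Δ,R{*})
  else ovAcc (strip A) B

-- Compute the designated structure once, over formulas extended by a hole symbol □:
-- C := designated R{□}{*}. Every R{Π}{*} is the image of R{□}{*} under the substitution
-- □ ↦ Π, and designated commutes with substitutions fixing * (it only rearranges star-free
-- subtrees), so designated R{Π}{*} = C{Π}. Moreover designated keeps every leaf other than *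
-- exactly once, so C contains □ exactly as often as R{□}{*} does, namely once.
module Submission where

open import Defs
open import Data.Bool using (true; false; _∨_)
open import Data.Bool.Properties using (∨-identityʳ; ∨-conicalˡ; ∨-conicalʳ)
open import Data.List using (List; []; _∷_; _++_; map; length; replicate)
open import Data.Nat using (ℕ; zero; suc; _+_; _∸_)
open import Data.Nat.Properties
  using (+-assoc; +-comm; +-identityʳ; ∸-+-assoc; +-commutativeSemigroup)
open import Algebra.Properties.CommutativeSemigroup +-commutativeSemigroup
  using (x∙yz≈y∙xz; xy∙z≈y∙zx)
open import Data.Product using (Σ; _×_; _,_; proj₁; proj₂)
import Data.Product as Product
open import Data.Sum using (_⊎_; inj₁; inj₂)
import Data.Sum as Sum
open import Function using (const; _∘_)
open import Relation.Binary.PropositionalEquality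
  using (_≡_; refl; sym; trans; cong; cong₂; module ≡-Reasoning)

private
  variable
    A B X : Set

bind : (A → Tree B) → Tree A → Tree B
bind σ ∅ = ∅
bind σ (leaf a) = σ a
bind σ (l ,, r) = bind σ l ,, bind σ r

lift : (A → Tree B) → A ⊎ X → Tree (B ⊎ X)
lift σ (inj₁ a) = mapT inj₁ (σ a)
lift σ (inj₂ x) = leaf (inj₂ x)

fillHoles : Tree A → A ⊎ Hole → Tree A
fillHoles Π = Sum.[ leaf , const Π ]

count : (A → ℕ) → Tree A → ℕ
count w ∅ = 0
count w (leaf a) = w a
count w (l ,, r) = count w l + count w r

mapT-cong : {f g : A → B} → (∀ x → f x ≡ g x) → (t : Tree A) → mapT f t ≡ mapT g t
mapT-cong f≗g ∅ = refl
mapT-cong f≗g (leaf x) = cong leaf (f≗g x)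
mapT-cong f≗g (l ,, r) = cong₂ _,,_ (mapT-cong f≗g l) (mapT-cong f≗g r)

bind-mapT : (σ : B → Tree X) (f : A → B) (t : Tree A) →
  bind σ (mapT f t) ≡ bind (σ ∘ f) t
bind-mapT σ f ∅ = refl
bind-mapT σ f (leaf _) = refl
bind-mapT σ f (l ,, r) = cong₂ _,,_ (bind-mapT σ f l) (bind-mapT σ f r)

bind-leaves : {σ : A → Tree B} {g : A → B} → (∀ a → σ a ≡ leaf (g a)) → (t : Tree A) →
  bind σ t ≡ mapT g t
bind-leaves σ≗leaf ∅ = refl
bind-leaves σ≗leaf (leaf a) = σ≗leaf a
bind-leaves σ≗leaf (l ,, r) = cong₂ _,,_ (bind-leaves σ≗leaf l) (bind-leaves σ≗leaf r)

hasStar-mapT-inj₁ : (Γ : Tree A) → hasStar (mapT inj₁ Γ) ≡ false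
hasStar-mapT-inj₁ ∅ = refl
hasStar-mapT-inj₁ (leaf _) = refl
hasStar-mapT-inj₁ (l ,, r) = cong₂ _∨_ (hasStar-mapT-inj₁ l) (hasStar-mapT-inj₁ r)

strip-mapT-inj₁ : (Γ : Tree A) → strip (mapT inj₁ Γ) ≡ Γ
strip-mapT-inj₁ ∅ = refl
strip-mapT-inj₁ (leaf _) = refl
strip-mapT-inj₁ (l ,, r) = cong₂ _,,_ (strip-mapT-inj₁ l) (strip-mapT-inj₁ r)

hasStar-bind-lift : (σ : A → Tree B) (T : SStr A) → hasStar (bind (lift σ) T) ≡ hasStar T
hasStar-bind-lift σ ∅ = refl
hasStar-bind-lift σ (leaf (inj₁ a)) = hasStar-mapT-inj₁ (σ a)
hasStar-bind-lift σ (leaf (inj₂ ★)) = refl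
hasStar-bind-lift σ (l ,, r) = cong₂ _∨_ (hasStar-bind-lift σ l) (hasStar-bind-lift σ r)

strip-bind-lift : (σ : A → Tree B) (T : SStr A) → strip (bind (lift σ) T) ≡ bind σ (strip T)
strip-bind-lift σ ∅ = refl
strip-bind-lift σ (leaf (inj₁ a)) = strip-mapT-inj₁ (σ a)
strip-bind-lift σ (leaf (inj₂ ★)) = refl
strip-bind-lift σ (l ,, r) = cong₂ _,,_ (strip-bind-lift σ l) (strip-bind-lift σ r)

ovAcc-bind-lift : (σ : A → Tree B) (Γ : Str A) (T : SStr A) → hasStar T ≡ true →
  ovAcc (bind σ Γ) (bind (lift σ) T) ≡ bind σ (ovAcc Γ T)
ovAcc-bind-lift σ Γ (leaf (inj₂ ★)) _ = refl
ovAcc-bind-lift σ Γ (A ,, B) hasStarAB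
  rewrite hasStar-bind-lift σ B | strip-bind-lift σ A | strip-bind-lift σ B
  with hasStar B in hasStarB
... | true = ovAcc-bind-lift σ (Γ ,, strip A) B hasStarB
... | false = ovAcc-bind-lift σ (strip B ,, Γ) A (trans (sym (∨-identityʳ _)) hasStarAB)

designated-bind-lift : (σ : A → Tree B) (T : SStr A) → hasStar T ≡ true →
  designated (bind (lift σ) T) ≡ bind σ (designated T)
designated-bind-lift σ (leaf (inj₂ ★)) _ = refl
designated-bind-lift σ (A ,, B) hasStarAB
  rewrite hasStar-bind-lift σ A | strip-bind-lift σ A | strip-bind-lift σ B
  with hasStar A in hasStarA
... | true = ovAcc-bind-lift σ (strip B) A hasStarA
... | false = ovAcc-bind-lift σ (strip A) B hasStarAB

fill-mapT-inj₁ : (Γ : Tree A) (ts : List (Tree A)) → fill (mapT inj₁ Γ) ts ≡ (Γ , ts)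
fill-mapT-inj₁ ∅ ts = refl
fill-mapT-inj₁ (leaf _) ts = refl
fill-mapT-inj₁ (l ,, r) ts rewrite fill-mapT-inj₁ l ts | fill-mapT-inj₁ r ts = refl

fill-bind-lift : (σ : A → Tree B) (C : Tree (A ⊎ Hole)) (ts : List (Tree A)) →
  fill (bind (lift σ) C) (map (bind σ) ts) ≡ Product.map (bind σ) (map (bind σ)) (fill C ts)
fill-bind-lift σ ∅ ts = refl
fill-bind-lift σ (leaf (inj₁ a)) ts = fill-mapT-inj₁ (σ a) (map (bind σ) ts)
fill-bind-lift σ (leaf (inj₂ □)) [] = refl
fill-bind-lift σ (leaf (inj₂ □)) (t ∷ ts) = refl
fill-bind-lift σ (l ,, r) ts
  rewrite fill-bind-lift σ l ts | fill-bind-lift σ r (proj₂ (fill l ts)) = refl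

replicate-+-++ : ∀ m n {x : A} (ys : List A) →
  replicate (m + n) x ++ ys ≡ replicate m x ++ (replicate n x ++ ys)
replicate-+-++ zero n ys = refl
replicate-+-++ (suc m) n ys = cong (_ ∷_) (replicate-+-++ m n ys)

fill-replicate : (C : Tree (A ⊎ Hole)) (Π : Tree A) (ts : List (Tree A)) →
  fill C (replicate (holes C) Π ++ ts) ≡ (bind (fillHoles Π) C , ts)
fill-replicate ∅ Π ts = refl
fill-replicate (leaf (inj₁ _)) Π ts = refl
fill-replicate (leaf (inj₂ □)) Π ts = refl
fill-replicate (l ,, r) Π ts
  rewrite replicate-+-++ (holes l) (holes r) {Π} ts
        | fill-replicate l Π (replicate (holes r) Π ++ ts)
        | fill-replicate r Π ts = refl

plug-one-hole : (C : Tree (A ⊎ Hole)) → holes C ≡ 1 → (Π : Tree A) →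
  C [ Π ] ≡ bind (fillHoles Π) C
plug-one-hole C oneHole Π = begin
  C [ Π ]                               ≡⟨ cong (λ n → plug C (replicate n Π ++ [])) (sym oneHole) ⟩
  plug C (replicate (holes C) Π ++ [])  ≡⟨ cong proj₁ (fill-replicate C Π []) ⟩
  bind (fillHoles Π) C                  ∎
  where open ≡-Reasoning

count-mapT : (w : B → ℕ) (f : A → B) (t : Tree A) → count w (mapT f t) ≡ count (w ∘ f) t
count-mapT w f ∅ = refl
count-mapT w f (leaf _) = refl
count-mapT w f (l ,, r) = cong₂ _+_ (count-mapT w f l) (count-mapT w f r)

count-zero : {w : A → ℕ} → (∀ a → w a ≡ 0) → (t : Tree A) → count w t ≡ 0
count-zero w≗0 ∅ = refl
count-zero w≗0 (leaf a) = w≗0 a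
count-zero w≗0 (l ,, r) = cong₂ _+_ (count-zero w≗0 l) (count-zero w≗0 r)

rights : Tree (A ⊎ X) → ℕ
rights = count Sum.[ const 0 , const 1 ]

holes≡rights : (C : Ctx A) → holes C ≡ rights C
holes≡rights ∅ = refl
holes≡rights (leaf (inj₁ _)) = refl
holes≡rights (leaf (inj₂ □)) = refl
holes≡rights (l ,, r) = cong₂ _+_ (holes≡rights l) (holes≡rights r)

holes-mapT-map₁ : (f : A → B) (C : Ctx A) → holes (mapT (Sum.map₁ f) C) ≡ holes C
holes-mapT-map₁ f ∅ = refl
holes-mapT-map₁ f (leaf (inj₁ _)) = refl
holes-mapT-map₁ f (leaf (inj₂ □)) = refl
holes-mapT-map₁ f (l ,, r) = cong₂ _+_ (holes-mapT-map₁ f l) (holes-mapT-map₁ f r)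

rights-starFree : (T : SStr A) → hasStar T ≡ false → rights T ≡ 0
rights-starFree ∅ _ = refl
rights-starFree (leaf (inj₁ _)) _ = refl
rights-starFree (l ,, r) noStar = cong₂ _+_
  (rights-starFree l (∨-conicalˡ _ _ noStar)) (rights-starFree r (∨-conicalʳ _ _ noStar))

hasStar-rights : (T : SStr A) → rights T ≡ 1 → hasStar T ≡ true
hasStar-rights T oneStar with hasStar T in noStar
... | true = refl
... | false with trans (sym oneStar) (rights-starFree T noStar)
...   | ()

count-strip : (w : A → ℕ) (T : SStr A) → count w (strip T) ≡ count Sum.[ w , const 0 ] T
count-strip w ∅ = refl
count-strip w (leaf (inj₁ _)) = refl
count-strip w (leaf (inj₂ _)) = refl
count-strip w (l ,, r) = cong₂ _+_ (count-strip w l) (count-strip w r)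

count-ovAcc : (w : A → ℕ) (Γ : Str A) (T : SStr A) → hasStar T ≡ true →
  count w (ovAcc Γ T) ≡ count w Γ + count Sum.[ w , const 0 ] T
count-ovAcc w Γ (leaf (inj₂ ★)) _ = sym (+-identityʳ _)
count-ovAcc w Γ (A ,, B) hasStarAB with hasStar B in hasStarB
... | true rewrite count-ovAcc w (Γ ,, strip A) B hasStarB | count-strip w A =
  +-assoc (count w Γ) _ _
... | false rewrite count-ovAcc w (strip B ,, Γ) A (trans (sym (∨-identityʳ _)) hasStarAB)
                  | count-strip w B =
  xy∙z≈y∙zx (count Sum.[ w , const 0 ] B) (count w Γ) (count Sum.[ w , const 0 ] A)

count-designated : (w : A → ℕ) (T : SStr A) → hasStar T ≡ true →
  count w (designated T) ≡ count Sum.[ w , const 0 ] T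
count-designated w (leaf (inj₂ ★)) _ = refl
count-designated w (A ,, B) hasStarAB with hasStar A in hasStarA
... | true rewrite count-ovAcc w (strip B) A hasStarA | count-strip w B =
  +-comm (count Sum.[ w , const 0 ] B) _
... | false rewrite count-ovAcc w (strip A) B hasStarAB | count-strip w A = refl

countL : (A → ℕ) → List (Tree A) → ℕ
countL w [] = 0
countL w (t ∷ ts) = count w t + countL w ts

-- A hole meeting an exhausted list is filled with ∅, of weight 0, so no length hypothesis is needed.
count-fill : (w : A → ℕ) (C : Tree (A ⊎ Hole)) (ts : List (Tree A)) →
  count w (proj₁ (fill C ts)) + countL w (proj₂ (fill C ts)) ≡ count Sum.[ w , const 0 ] C + countL w ts
count-fill w ∅ ts = refl
count-fill w (leaf (inj₁ _)) ts = refl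
count-fill w (leaf (inj₂ □)) [] = refl
count-fill w (leaf (inj₂ □)) (t ∷ ts) = refl
count-fill w (l ,, r) ts = begin
  count w l′ + count w r′ + countL w ts″  ≡⟨ +-assoc (count w l′) _ _ ⟩
  count w l′ + (count w r′ + countL w ts″) ≡⟨ cong (count w l′ +_) (count-fill w r ts′) ⟩
  count w l′ + (cr + countL w ts′)        ≡⟨ x∙yz≈y∙xz (count w l′) cr (countL w ts′) ⟩
  cr + (count w l′ + countL w ts′)        ≡⟨ cong (cr +_) (count-fill w l ts) ⟩
  cr + (cl + countL w ts)                 ≡⟨ x∙yz≈y∙xz cr cl (countL w ts) ⟩
  cl + (cr + countL w ts)                 ≡⟨ +-assoc cl cr (countL w ts) ⟨
  cl + cr + countL w ts                   ∎
  where
  open ≡-Reasoning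
  l′ = proj₁ (fill l ts)
  ts′ = proj₂ (fill l ts)
  r′ = proj₁ (fill r ts′)
  ts″ = proj₂ (fill r ts′)
  cl = count Sum.[ w , const 0 ] l
  cr = count Sum.[ w , const 0 ] r

length-fill : (C : Tree (A ⊎ Hole)) (ts : List (Tree A)) →
  length (proj₂ (fill C ts)) ≡ length ts ∸ holes C
length-fill ∅ ts = refl
length-fill (leaf (inj₁ _)) ts = refl
length-fill (leaf (inj₂ □)) [] = refl
length-fill (leaf (inj₂ □)) (t ∷ ts) = refl
length-fill (l ,, r) ts = trans (length-fill r (proj₂ (fill l ts)))
  (trans (cong (_∸ holes r) (length-fill l ts)) (∸-+-assoc (length ts) (holes l) (holes r)))

length≡0⇒≡[] : (xs : List A) → length xs ≡ 0 → xs ≡ []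
length≡0⇒≡[] [] _ = refl

-- R ⟨ Π ⟩⟨★⟩ embeds R by a function local to its definition; this names the embedding.
⟨⟩⟨★⟩-as-plug : (R : Ctx A) (Π : Str A) →
  R ⟨ Π ⟩⟨★⟩ ≡ plug (mapT (Sum.map₁ inj₁) R) (mapT inj₁ Π ∷ leaf (inj₂ ★) ∷ [])
⟨⟩⟨★⟩-as-plug R Π =
  cong (λ D → plug D _) (mapT-cong (λ { (inj₁ _) → refl ; (inj₂ _) → refl }) R)

≡⇒≈ : {Γ Δ : Tree A} → Γ ≡ Δ → Γ ≈ Δ
≡⇒≈ refl = ≈-refl

module TwoHoles {Fm : Set} (R : Ctx Fm) (twoHoles : holes R ≡ 2) where

  R⁺ : Ctx (Fm ⊎ Hole)
  R⁺ = mapT (Sum.map₁ inj₁) R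

  T : SStr (Fm ⊎ Hole)
  T = R⁺ ⟨ leaf (inj₂ □) ⟩⟨★⟩

  private
    C⁺ : Ctx ((Fm ⊎ Hole) ⊎ Star)
    C⁺ = mapT (Sum.map₁ inj₁) R⁺

    □★ : List (SStr (Fm ⊎ Hole))
    □★ = leaf (inj₁ (inj₂ □)) ∷ leaf (inj₂ ★) ∷ []

  R⟨Π⟩⟨★⟩-from-T : (Π : Str Fm) → R ⟨ Π ⟩⟨★⟩ ≡ bind (lift (fillHoles Π)) T
  R⟨Π⟩⟨★⟩-from-T Π = begin
    R ⟨ Π ⟩⟨★⟩
      ≡⟨ ⟨⟩⟨★⟩-as-plug R Π ⟩
    plug (mapT (Sum.map₁ inj₁) R) (map (bind σ) □★)
      ≡⟨ cong (λ D → plug D (map (bind σ) □★)) (sym lift-C⁺) ⟩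
    plug (bind (lift σ) C⁺) (map (bind σ) □★)
      ≡⟨ cong proj₁ (fill-bind-lift σ C⁺ □★) ⟩
    bind σ (plug C⁺ □★)
      ≡⟨ cong (bind σ) (sym (⟨⟩⟨★⟩-as-plug R⁺ (leaf (inj₂ □)))) ⟩
    bind σ T ∎
    where
    open ≡-Reasoning
    σ = lift (fillHoles Π)
    lift-C⁺ : bind (lift σ) C⁺ ≡ mapT (Sum.map₁ inj₁) R
    lift-C⁺ = trans (bind-mapT (lift σ) _ R⁺)
      (trans (bind-mapT _ _ R) (bind-leaves (λ { (inj₁ _) → refl ; (inj₂ _) → refl }) R))

  fill-C⁺-consumes-□★ : proj₂ (fill C⁺ □★) ≡ []
  fill-C⁺-consumes-□★ = length≡0⇒≡[] _ (begin
    length (proj₂ (fill C⁺ □★))  ≡⟨ length-fill C⁺ □★ ⟩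
    2 ∸ holes C⁺                 ≡⟨ cong (2 ∸_) holes-C⁺ ⟩
    2 ∸ holes R                  ≡⟨ cong (2 ∸_) twoHoles ⟩
    0                            ∎)
    where
    open ≡-Reasoning
    holes-C⁺ : holes C⁺ ≡ holes R
    holes-C⁺ = trans (holes-mapT-map₁ inj₁ R⁺) (holes-mapT-map₁ inj₁ R)

  count-T : (w : (Fm ⊎ Hole) ⊎ Star → ℕ) → (∀ a → w (inj₁ (inj₁ a)) ≡ 0) →
    count w T ≡ w (inj₁ (inj₂ □)) + (w (inj₂ ★) + 0)
  count-T w formulas-weightless = begin
    count w T
      ≡⟨ cong (count w) (⟨⟩⟨★⟩-as-plug R⁺ _) ⟩
    count w (plug C⁺ □★)
      ≡⟨ sym (+-identityʳ _) ⟩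
    count w (plug C⁺ □★) + countL w []
      ≡⟨ cong ((count w (plug C⁺ □★) +_) ∘ countL w) (sym fill-C⁺-consumes-□★) ⟩
    count w (plug C⁺ □★) + countL w (proj₂ (fill C⁺ □★))
      ≡⟨ count-fill w C⁺ □★ ⟩
    count Sum.[ w , const 0 ] C⁺ + countL w □★
      ≡⟨ cong (_+ countL w □★) C⁺-weightless ⟩
    countL w □★ ∎
    where
    open ≡-Reasoning
    C⁺-weightless : count Sum.[ w , const 0 ] C⁺ ≡ 0
    C⁺-weightless = trans (count-mapT _ _ R⁺) (trans (count-mapT _ _ R)
      (count-zero (λ { (inj₁ a) → formulas-weightless a ; (inj₂ _) → refl }) R))

  C : Ctx Fm
  C = designated T

  hasStar-T : hasStar T ≡ true
  hasStar-T = hasStar-rights T (count-T _ (λ _ → refl))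

  holes-C : holes C ≡ 1
  holes-C = trans (holes≡rights C)
    (trans (count-designated _ T hasStar-T) (count-T _ (λ _ → refl)))

  designated-R⟨Π⟩⟨★⟩ : (Π : Str Fm) → designated (R ⟨ Π ⟩⟨★⟩) ≡ C [ Π ]
  designated-R⟨Π⟩⟨★⟩ Π = begin
    designated (R ⟨ Π ⟩⟨★⟩)                 ≡⟨ cong designated (R⟨Π⟩⟨★⟩-from-T Π) ⟩
    designated (bind (lift (fillHoles Π)) T) ≡⟨ designated-bind-lift (fillHoles Π) T hasStar-T ⟩
    bind (fillHoles Π) C                     ≡⟨ sym (plug-one-hole C holes-C Π) ⟩
    C [ Π ]                                  ∎
    where open ≡-Reasoning

lemma2p3 : {Fm : Set} (R : Ctx Fm) → holes R ≡ 2 → (Δ : Str Fm) →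
    Σ (Ctx Fm) (λ C → holes C ≡ 1 × designated (R ⟨ Δ ⟩⟨★⟩) ≈ C [ Δ ]
    × ((Π : Str Fm) → designated (R ⟨ Π ⟩⟨★⟩) ≈ C [ Π ]))
lemma2p3 R twoHoles Δ =
  C , holes-C , ≡⇒≈ (designated-R⟨Π⟩⟨★⟩ Δ) , λ Π → ≡⇒≈ (designated-R⟨Π⟩⟨★⟩ Π)
  where open TwoHoles R twoHoles
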